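{- Let $n$ and $p$ be positive integers and let $G$ be the $n\times n$ complete bipartite graph $K_{n,n}$. Every shuffle-preserved $2$-local coloring of $G$ contains a monochromatic copy of $K_{p,p}$ if and only if $2(p-1)<n$.
   Context: $G$ has bipartition $U\cup V$, $|U|=|V|=n$. A coloring assigns a color to each edge. For a vertex $u$, $C(u)$ is the set of colors on edges incident to $u$; a coloring is $2$-local if $|C(u)|\le 2$ for every vertex $u$ (the total number of colors may exceed $2$). Write $(u,v)_c$ if the edge $uv$ has color $c$. A coloring is shuffle-preserved if for all $u,u'\in U$, $v,v'\in V$ and every color $c$, $(u,v)_c$ and $(u',v')_c$ imply $(u,v')_c$ and $(u',v)_c$. A monochromatic copy of $K_{p,p}$ consists of $A\subseteq U$, $B\subseteq V$ with $|A|=|B|=p$ and a color $c$ with $(a,b)_c$ for all $a\in A$, $b\in B$. -}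

module Defs where

open import Data.Nat using (ℕ)
open import Data.Fin using (Fin)
open import Data.Product using (Σ; ∃; _×_)
open import Data.Sum using (_⊎_)
open import Function.Definitions using (Injective)
open import Relation.Binary.PropositionalEquality using (_≡_)

-- An edge coloring of K_{n,n} with U = V = Fin n; colors are natural numbers
-- (any coloring of the n² edges can be relabelled into ℕ).
Coloring : ℕ → Set
Coloring n = Fin n → Fin n → ℕ

TwoLocal : ∀ {n} → Coloring n → Set
TwoLocal {n} col =
  ((u : Fin n) → Σ ℕ λ c₁ → Σ ℕ λ c₂ → (v : Fin n) → col u v ≡ c₁ ⊎ col u v ≡ c₂) ×
  ((v : Fin n) → Σ ℕ λ c₁ → Σ ℕ λ c₂ → (u : Fin n) → col u v ≡ c₁ ⊎ col u v ≡ c₂)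

ShufflePreserved : ∀ {n} → Coloring n → Set
ShufflePreserved {n} col =
  (u u' : Fin n) (v v' : Fin n) (c : ℕ) →
  col u v ≡ c → col u' v' ≡ c → (col u v' ≡ c) × (col u' v ≡ c)

HasMonoKpp : ∀ {n} → ℕ → Coloring n → Set
HasMonoKpp {n} p col =
  Σ (Fin p → Fin n) λ A → Σ (Fin p → Fin n) λ B → Σ ℕ λ c →
    Injective _≡_ _≡_ A × Injective _≡_ _≡_ B ×
    ((i j : Fin p) → col (A i) (B j) ≡ c)

-- In a shuffle-preserved colouring every colour class is a combinatorial
-- rectangle R × S, so a monochromatic K_{p,p} is a colour with |R|, |S| ≥ p.
-- Let n ≥ 2p − 1. By 2-locality some row z has a colour k on a set S of at
-- least p columns. Either k also occupies p rows, or the set N of rows outside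
-- it has at least p elements; every column of S then carries k and exactly one
-- other colour, which is constant on N. Take u₀ ∈ N and a colour e of u₀ on at
-- least p columns. If some column of S shows e in row u₀, then e fills N times
-- the e-columns of u₀; otherwise row u₀ is constant on S and N × S is
-- monochromatic.
-- Conversely, for n ≤ 2(p − 1), colouring each row by the half of U it lies in
-- is shuffle-preserved and 2-local, and each half has fewer than p rows.
module Submission where

open import Defs
open import Data.Nat using (ℕ; zero; suc; _+_; _*_; _∸_; _<_; _≤_; z≤n; s≤s; s≤s⁻¹; NonZero; _≟_; _<?_)
open import Data.Nat.Properties hiding (suc-injective)
open import Data.Bool using (if_then_else_)
open import Data.Fin using (Fin; zero; suc; toℕ; fromℕ<; opposite; lift)
open import Data.Fin.Properties
  using (suc-injective; toℕ<n; toℕ-injective; fromℕ<-injective; injective⇒≤; lift-injective;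
         opposite-prop; opposite-involutive; any?)
open import Data.Product using (Σ; ∃; _×_; _,_; proj₁; proj₂)
open import Data.Sum using (_⊎_; inj₁; inj₂)
open import Data.Empty using (⊥)
open import Function using (case_of_)
open import Function.Definitions using (Injective)
open import Function.Bundles using (_⇔_; mk⇔)
open import Relation.Nullary using (Dec; yes; no; ¬_; ¬?; does; contradiction)
open import Relation.Nullary.Decidable using (_×-dec_; toSum)
open import Relation.Binary.PropositionalEquality

private
  variable
    n p q : ℕ

AtMostTwoValues : (Fin n → ℕ) → Set
AtMostTwoValues {n} f = Σ ℕ λ c₁ → Σ ℕ λ c₂ → (i : Fin n) → f i ≡ c₁ ⊎ f i ≡ c₂

other-value : {f : Fin n → ℕ} → AtMostTwoValues f →
  ∀ {a b c} → f b ≢ f a → f c ≢ f a → f c ≡ f b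
other-value (_ , _ , two) {a} {b} {c} b≢a c≢a with two a | two b | two c
... | inj₁ a≡ | inj₁ b≡ | _       = contradiction (trans b≡ (sym a≡)) b≢a
... | inj₂ a≡ | inj₂ b≡ | _       = contradiction (trans b≡ (sym a≡)) b≢a
... | _       | inj₁ b≡ | inj₁ c≡ = trans c≡ (sym b≡)
... | _       | inj₂ b≡ | inj₂ c≡ = trans c≡ (sym b≡)
... | inj₁ a≡ | _       | inj₁ c≡ = contradiction (trans c≡ (sym a≡)) c≢a
... | inj₂ a≡ | _       | inj₂ c≡ = contradiction (trans c≡ (sym a≡)) c≢a

count : {P : Fin n → Set} → ((i : Fin n) → Dec (P i)) → ℕ
count {zero}  P? = 0
count {suc n} P? = (if does (P? zero) then 1 else 0) + count (λ i → P? (suc i))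

count-⊎ : {P Q : Fin n → Set} (P? : ∀ i → Dec (P i)) (Q? : ∀ i → Dec (Q i)) →
  (∀ i → P i ⊎ Q i) → n ≤ count P? + count Q?
count-⊎ {zero}  P? Q? P⊎Q = z≤n
count-⊎ {suc n} P? Q? P⊎Q with P? zero | Q? zero | count-⊎ _ _ (λ i → P⊎Q (suc i))
... | yes _ | yes _ | ih = s≤s (≤-trans ih (+-monoʳ-≤ _ (n≤1+n _)))
... | yes _ | no _  | ih = s≤s ih
... | no _  | yes _ | ih = subst (suc n ≤_) (sym (+-suc _ _)) (s≤s ih)
... | no ¬p | no ¬q | _  with P⊎Q zero
...   | inj₁ p = contradiction p ¬p
...   | inj₂ q = contradiction q ¬q

Selection : (p : ℕ) → (Fin n → Set) → Set
Selection {n} p P = Σ (Fin p → Fin n) λ A → Injective _≡_ _≡_ A × (∀ i → P (A i))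

selection : {P : Fin n → Set} (P? : ∀ i → Dec (P i)) → p ≤ count P? → Selection p P
selection {p = zero} P? _ = (λ ()) , (λ { {()} }) , (λ ())
selection {zero} {suc p} P? ()
selection {suc n} {suc p} P? p≤ with P? zero
... | yes P0 =
  let A , A-inj , PA = selection (λ i → P? (suc i)) (s≤s⁻¹ p≤)
  in lift 1 A , lift-injective A A-inj 1 , λ { zero → P0 ; (suc i) → PA i }
... | no _ =
  let A , A-inj , PA = selection (λ i → P? (suc i)) p≤
  in (λ i → suc (A i)) , (λ eq → A-inj (suc-injective eq)) , PA

count>p⇒∃ : {P : Fin n → Set} (P? : ∀ i → Dec (P i)) → p < count P? → ∃ P
count>p⇒∃ P? p<count = let A , _ , PA = selection P? p<count in A zero , PA zero

2q<m+n⇒q<m⊎q<n : ∀ {m n} → 2 * q < m + n → q < m ⊎ q < n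
2q<m+n⇒q<m⊎q<n {q} {m} {n} 2q<m+n with q <? m | q <? n
... | yes q<m | _     = inj₁ q<m
... | no _    | yes q<n = inj₂ q<n
... | no q≮m  | no q≮n = contradiction 2q<m+n (≤⇒≯ (begin
  m + n       ≤⟨ +-mono-≤ (≮⇒≥ q≮m) (≮⇒≥ q≮n) ⟩
  q + q       ≡⟨ cong (q +_) (sym (+-identityʳ q)) ⟩
  2 * q       ∎))
  where open ≤-Reasoning

majority-value : {f : Fin n → ℕ} → AtMostTwoValues f → 2 * q < n →
  ∃ λ c → q < count (λ i → f i ≟ c)
majority-value {f = f} (c₁ , c₂ , two) 2q<n
  with 2q<m+n⇒q<m⊎q<n (<-≤-trans 2q<n (count-⊎ (λ i → f i ≟ c₁) (λ i → f i ≟ c₂) two))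
... | inj₁ q<m = c₁ , q<m
... | inj₂ q<n = c₂ , q<n

count-∁ : {P : Fin n → Set} (P? : ∀ i → Dec (P i)) → 2 * q < n →
  ¬ (q < count P?) → q < count (λ i → ¬? (P? i))
count-∁ P? 2q<n q≮count
  with 2q<m+n⇒q<m⊎q<n (<-≤-trans 2q<n (count-⊎ P? (λ i → ¬? (P? i)) (λ i → toSum (P? i))))
... | inj₁ q<count = contradiction q<count q≮count
... | inj₂ q<count = q<count

rectangle⇒monoKpp : {col : Coloring n} {P Q : Fin n → Set}
  (P? : ∀ i → Dec (P i)) (Q? : ∀ i → Dec (Q i)) {c : ℕ} →
  p ≤ count P? → p ≤ count Q? → (∀ u v → P u → Q v → col u v ≡ c) → HasMonoKpp p col
rectangle⇒monoKpp P? Q? {c} P-large Q-large mono =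
  let A , A-inj , PA = selection P? P-large
      B , B-inj , QB = selection Q? Q-large
  in A , B , c , A-inj , B-inj , λ i j → mono (A i) (B j) (PA i) (QB j)

module LargeMonochromaticRectangle
  (2q<n : 2 * q < n) (col : Coloring n) (two-local : TwoLocal col) (shuffle : ShufflePreserved col)
  where

  majority : ∀ u → ∃ λ c → q < count (λ v → col u v ≟ c)
  majority u = majority-value (proj₁ two-local u) 2q<n

  monoKpp-outside-class : ∀ {z b k} → col z b ≡ k →
    q < count (λ v → col z v ≟ k) → q < count (λ u → ¬? (col u b ≟ k)) →
    HasMonoKpp (suc q) col
  monoKpp-outside-class {z} {b} {k} zb≡k S-large N-large =
    rectangle (any? (λ v → (col z v ≟ k) ×-dec (col u₀ v ≟ e)))
    where
    u₀ : Fin n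
    u₀ = proj₁ (count>p⇒∃ (λ u → ¬? (col u b ≟ k)) N-large)
    u₀b≢k : col u₀ b ≢ k
    u₀b≢k = proj₂ (count>p⇒∃ (λ u → ¬? (col u b ≟ k)) N-large)
    e : ℕ
    e = proj₁ (majority u₀)
    E-large : q < count (λ v → col u₀ v ≟ e)
    E-large = proj₂ (majority u₀)

    off-k : ∀ {u v} → col z v ≡ k → col u b ≢ k → col u v ≢ k
    off-k {u} {v} zv≡k ub≢k uv≡k = ub≢k (proj₁ (shuffle u z v b k uv≡k zb≡k))

    -- column v has colour k at z, so its only other colour fills N
    constant-on-N : ∀ {u v} → col z v ≡ k → col u b ≢ k → col u v ≡ col u₀ v
    constant-on-N {u} {v} zv≡k ub≢k = other-value (proj₂ two-local v) {a = z}
      (λ eq → off-k zv≡k u₀b≢k (trans eq zv≡k)) (λ eq → off-k zv≡k ub≢k (trans eq zv≡k))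

    rectangle : Dec (∃ λ v → col z v ≡ k × col u₀ v ≡ e) → HasMonoKpp (suc q) col
    rectangle (yes (v , zv≡k , u₀v≡e)) = rectangle⇒monoKpp _ _ N-large E-large
      λ u v′ ub≢k u₀v′≡e → proj₁ (shuffle u u₀ v v′ e (trans (constant-on-N zv≡k ub≢k) u₀v≡e) u₀v′≡e)
    rectangle (no ¬SE) = rectangle⇒monoKpp _ _ N-large S-large
      λ u v ub≢k zv≡k → trans (constant-on-N zv≡k ub≢k) (u₀-constant-on-S zv≡k)
      where
      vₑ : Fin n
      vₑ = proj₁ (count>p⇒∃ (λ v → col u₀ v ≟ e) E-large)
      u₀vₑ≡e : col u₀ vₑ ≡ e
      u₀vₑ≡e = proj₂ (count>p⇒∃ (λ v → col u₀ v ≟ e) E-large)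
      u₀-constant-on-S : ∀ {v} → col z v ≡ k → col u₀ v ≡ col u₀ b
      u₀-constant-on-S {v} zv≡k = other-value (proj₁ two-local u₀) {a = vₑ}
        (λ eq → ¬SE (b , zb≡k , trans eq u₀vₑ≡e)) (λ eq → ¬SE (v , zv≡k , trans eq u₀vₑ≡e))

  monoKpp : HasMonoKpp (suc q) col
  monoKpp with majority (fromℕ< (≤-trans (s≤s z≤n) 2q<n))
  ... | k , S-large with count>p⇒∃ _ S-large
  ... | b , zb≡k with q <? count (λ u → col u b ≟ k)
  ... | yes R-large = rectangle⇒monoKpp _ _ R-large S-large
          λ u v ub≡k zv≡k → proj₁ (shuffle u _ b v k ub≡k zv≡k)
  ... | no R-small = monoKpp-outside-class zb≡k S-large (count-∁ _ 2q<n R-small)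

rowwise-shufflePreserved : (κ : Fin n → ℕ) → ShufflePreserved (λ u v → κ u)
rowwise-shufflePreserved κ u u′ v v′ c κu≡c κu′≡c = κu≡c , κu′≡c

rowwise-twoLocal : {κ : Fin n → ℕ} → AtMostTwoValues κ → TwoLocal (λ u v → κ u)
rowwise-twoLocal {κ = κ} two = (λ u → κ u , κ u , λ _ → inj₁ refl) , (λ _ → two)

injective-below⇒≤ : {A : Fin p → Fin n} → Injective _≡_ _≡_ A → (∀ i → toℕ (A i) < q) → p ≤ q
injective-below⇒≤ A-inj below = injective⇒≤ λ {i} {j} eq →
  A-inj (toℕ-injective (fromℕ<-injective _ _ (below i) (below j) eq))

opposite-below : n ≤ 2 * q → (i : Fin n) → q ≤ toℕ i → toℕ (opposite i) < q
opposite-below {n} {q} n≤2q i q≤i = begin-strict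
  toℕ (opposite i)              ≡⟨ opposite-prop i ⟩
  n ∸ suc (toℕ i)               <⟨ ∸-monoˡ-< n<q+1+i (toℕ<n i) ⟩
  q + suc (toℕ i) ∸ suc (toℕ i) ≡⟨ m+n∸n≡m q (suc (toℕ i)) ⟩
  q                             ∎
  where
  open ≤-Reasoning
  n<q+1+i : n < q + suc (toℕ i)
  n<q+1+i = ≤-<-trans (≤-trans n≤2q (≤-reflexive (cong (q +_) (+-identityʳ q)))) (+-monoʳ-< q (s≤s q≤i))

half : ℕ → Fin n → ℕ
half q u with toℕ u <? q
... | yes _ = 0
... | no _  = 1

half-0-or-1 : ∀ q (u : Fin n) → half q u ≡ 0 ⊎ half q u ≡ 1
half-0-or-1 q u with toℕ u <? q
... | yes _ = inj₁ refl
... | no _  = inj₂ refl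

half-below : ∀ {u u′ : Fin n} → half q u ≡ half q u′ → toℕ u < q → toℕ u′ < q
half-below {q = q} {u} {u′} eq u<q with toℕ u <? q | toℕ u′ <? q
... | _      | yes u′<q = u′<q
... | yes _  | no _     = case eq of λ ()
... | no u≮q | no _     = contradiction u<q u≮q

halves-noMonoKpp : n ≤ 2 * q → ¬ HasMonoKpp (suc q) (λ u v → half q u)
halves-noMonoKpp {q = q} n≤2q (A , _ , _ , A-inj , _ , mono) = no-large-half (toℕ (A zero) <? q)
  where
  same : ∀ i j → half q (A i) ≡ half q (A j)
  same i j = trans (mono i zero) (sym (mono j zero))

  opposite-A-inj : Injective _≡_ _≡_ (λ i → opposite (A i))
  opposite-A-inj {i} {j} eq = A-inj (begin
    A i                       ≡⟨ opposite-involutive (A i) ⟨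
    opposite (opposite (A i)) ≡⟨ cong opposite eq ⟩
    opposite (opposite (A j)) ≡⟨ opposite-involutive (A j) ⟩
    A j                       ∎)
    where open ≡-Reasoning

  no-large-half : Dec (toℕ (A zero) < q) → ⊥
  no-large-half (yes A₀<q) = contradiction
    (injective-below⇒≤ A-inj λ i → half-below (same zero i) A₀<q) 1+n≰n
  no-large-half (no A₀≮q) = contradiction
    (injective-below⇒≤ opposite-A-inj λ i → opposite-below n≤2q (A i)
      (≮⇒≥ λ Aᵢ<q → A₀≮q (half-below (same i zero) Aᵢ<q))) 1+n≰n

theorem2 : (n p : ℕ) → .{{_ : NonZero n}} → .{{_ : NonZero p}} →
    ((col : Coloring n) → TwoLocal col → ShufflePreserved col → HasMonoKpp p col)
      ⇔ (2 * (p ∸ 1) < n)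
theorem2 n (suc q) = mk⇔
  (λ every-coloring → ≰⇒> λ n≤2q → halves-noMonoKpp n≤2q
    (every-coloring _ (rowwise-twoLocal (0 , 1 , half-0-or-1 q)) (rowwise-shufflePreserved _)))
  (λ 2q<n col two-local shuffle → LargeMonochromaticRectangle.monoKpp 2q<n col two-local shuffle)
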